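{- Let $\mathbb{G}$ be a finite reflexive digraph which is a poset, or a symmetric digraph, or an intransitive digraph. If $\mathbb{G}$ is idempotent trivial, then the identity is isolated in $Hom(\mathbb{G},\mathbb{G})$, i.e. it is alone in its connected component of $Hom(\mathbb{G},\mathbb{G})$.
   Context: All digraphs are finite and reflexive. A poset is a digraph whose arc relation is reflexive, antisymmetric and transitive; a digraph is symmetric if $x\to y$ implies $y\to x$; a digraph is intransitive if there are no three distinct vertices $x,y,z$ with $x\to y$, $y\to z$ and $x\to z$. A $k$-ary polymorphism is a homomorphism from the $k$-fold product $\mathbb{G}^k$ to $\mathbb{G}$; it is idempotent if $f(x,\dots,x)=x$ for all $x$; $\mathbb{G}$ is idempotent trivial if for all $k\ge2$ all idempotent $k$-ary polymorphisms are projections. $Hom(\mathbb{G},\mathbb{G})$ has as vertices the endomorphisms of $\mathbb{G}$, with an arc $(f,g)$ iff $(f(x),g(y))$ is an arc whenever $(x,y)$ is; connected components are those of the underlying undirected graph. -}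

module Defs where

open import Level using (Level; 0ℓ)
open import Data.Nat using (ℕ; _≥_)
open import Data.Fin using (Fin)
open import Data.Product using (Σ; ∃; _×_; _,_; proj₁)
open import Relation.Binary.PropositionalEquality using (_≡_; _≢_)
open import Relation.Nullary using (¬_)
open import Relation.Binary.Construct.Closure.Equivalence using (EqClosure)

record Digraph : Set₁ where
  field
    n : ℕ
    E : Fin n → Fin n → Set
open Digraph public

V : Digraph → Set
V G = Fin (n G)

Reflexive : Digraph → Set
Reflexive G = ∀ x → E G x x

IsPoset : Digraph → Set
IsPoset G = (∀ x → E G x x)
          × (∀ x y → E G x y → E G y x → x ≡ y)
          × (∀ x y z → E G x y → E G y z → E G x z)

IsSymmetric : Digraph → Set
IsSymmetric G = ∀ x y → E G x y → E G y x

IsIntransitive : Digraph → Set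
IsIntransitive G = ∀ x y z → x ≢ y → y ≢ z → x ≢ z →
                   ¬ (E G x y × E G y z × E G x z)

Op : Digraph → ℕ → Set
Op G k = (Fin k → V G) → V G

-- homomorphism G^k → G (arcs of G^k are coordinatewise arcs)
IsPolymorphism : (G : Digraph) (k : ℕ) → Op G k → Set
IsPolymorphism G k f = ∀ (x y : Fin k → V G) → (∀ i → E G (x i) (y i)) → E G (f x) (f y)

IsIdempotent : (G : Digraph) (k : ℕ) → Op G k → Set
IsIdempotent G k f = ∀ (v : V G) → f (λ _ → v) ≡ v

IsProjection : (G : Digraph) (k : ℕ) → Op G k → Set
IsProjection G k f = ∃ λ (i : Fin k) → ∀ (x : Fin k → V G) → f x ≡ x i

IdempotentTrivial : Digraph → Set
IdempotentTrivial G = ∀ (k : ℕ) → k ≥ 2 → (f : Op G k) →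
  IsPolymorphism G k f → IsIdempotent G k f → IsProjection G k f

IsEndo : (G : Digraph) → (V G → V G) → Set
IsEndo G g = ∀ x y → E G x y → E G (g x) (g y)

Endo : Digraph → Set
Endo G = Σ (V G → V G) (IsEndo G)

HomArc : (G : Digraph) → Endo G → Endo G → Set
HomArc G f g = ∀ x y → E G x y → E G (proj₁ f x) (proj₁ g y)

idEndo : (G : Digraph) → Endo G
idEndo G = (λ x → x) , (λ x y e → e)

-- same connected component of the underlying undirected graph of Hom(G,G)
Connected : (G : Digraph) → Endo G → Endo G → Set
Connected G = EqClosure (HomArc G)

-- the identity is alone in its connected component
-- (endomorphisms are compared as functions, pointwise)
IdIsolated : Digraph → Set
IdIsolated G = ∀ (f : Endo G) → Connected G (idEndo G) f → ∀ x → proj₁ f x ≡ x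

-- Suppose f is joined to the identity by an arc of Hom(G,G), i.e. x → y implies x → f y,
-- and f a ≠ a. From f we build a binary idempotent polymorphism that is neither projection:
-- for symmetric or intransitive G, (x , y) ↦ f a if y = a ≠ x and y otherwise; for a poset,
-- (x , y) ↦ f x if y is a fixed maximal element c and x otherwise. Hence f is the identity.
-- Arcs into the identity reduce to this case in the opposite digraph, and the claim spreads
-- along any path of Hom(G,G) starting at the identity.
module Submission where

open import Defs
open import Data.Sum using (_⊎_; inj₁; inj₂)
open import Data.Nat using (ℕ; zero; suc; z≤n; s≤s; _≤′_; ≤′-refl; ≤′-step)
open import Data.Nat.Properties using (n<1+n; ≤⇒≤′)
open import Data.Fin using (Fin; zero; suc; toℕ)
open import Data.Fin.Properties using (_≟_; pigeonhole)
open import Data.Vec.Functional using ([]; _∷_)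
open import Data.Product using (Σ; ∃; _×_; _,_; proj₁; proj₂)
open import Data.Empty using (⊥; ⊥-elim)
open import Function using (_∘_; id)
open import Relation.Nullary using (¬_; yes; no)
open import Relation.Binary.Core using (_Preserves₂_⟶_⟶_)
open import Relation.Binary.PropositionalEquality using (_≡_; _≢_; _≗_; refl; sym; trans; subst)
open import Relation.Binary.Construct.Closure.ReflexiveTransitive using (Star; ε; _◅_)
open import Relation.Binary.Construct.Closure.Symmetric using (SymClosure; fwd; bwd)

¬¬-∀-Fin : ∀ {p} n {P : Fin n → Set p} → (∀ i → ¬ ¬ P i) → ¬ ¬ (∀ i → P i)
¬¬-∀-Fin zero    ¬¬P ¬∀P = ¬∀P λ ()
¬¬-∀-Fin (suc n) ¬¬P ¬∀P =
  ¬¬P zero λ P₀ → ¬¬-∀-Fin n (λ i → ¬¬P (suc i)) λ P₊ →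
  ¬∀P λ { zero → P₀ ; (suc i) → P₊ i }

orbit : ∀ {a} {A : Set a} → (A → A) → A → ℕ → A
orbit next x zero    = x
orbit next x (suc i) = next (orbit next x i)

module _ (G : Digraph) where
  private
    infix 4 _⇒_
    _⇒_ : V G → V G → Set
    _⇒_ = E G

  binary-polymorphism-is-projection :
    IdempotentTrivial G → (M : V G → V G → V G) →
    M Preserves₂ _⇒_ ⟶ _⇒_ ⟶ _⇒_ → (∀ x → M x x ≡ x) →
    (∀ x y → M x y ≡ x) ⊎ (∀ x y → M x y ≡ y)
  binary-polymorphism-is-projection trivial M M-poly M-idem
    with trivial 2 (s≤s (s≤s z≤n)) (λ t → M (t zero) (t (suc zero)))
                   (λ _ _ e → M-poly (e zero) (e (suc zero))) M-idem
  ... | zero     , M≡π = inj₁ λ x y → M≡π (x ∷ y ∷ [])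
  ... | suc zero , M≡π = inj₂ λ x y → M≡π (x ∷ y ∷ [])

  Maximal : V G → Set
  Maximal c = ∀ z → c ⇒ z → z ≡ c

  module _ (poset : IsPoset G) where
    private
      ⇒-refl    = proj₁ poset
      ⇒-antisym = proj₁ (proj₂ poset)
      ⇒-trans   = proj₂ (proj₂ poset)

    orbit-ascending : ∀ next → (∀ x → x ⇒ next x) → ∀ a {i j} → i ≤′ j →
                      orbit next a i ⇒ orbit next a j
    orbit-ascending next inflationary a ≤′-refl = ⇒-refl _
    orbit-ascending next inflationary a (≤′-step i≤j) =
      ⇒-trans _ _ _ (orbit-ascending next inflationary a i≤j) (inflationary _)

    no-strict-successor-function :
      V G → (next : V G → V G) → (∀ x → x ⇒ next x) → (∀ x → next x ≢ x) → ⊥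
    no-strict-successor-function a next inflationary strict
      with i , j , i<j , orbitᵢ≡orbitⱼ ← pigeonhole (n<1+n (n G)) (λ j → orbit next a (toℕ j))
      = strict _ (⇒-antisym _ _ orbitᵢ₊₁⇒orbitᵢ (inflationary _))
      where
      orbitᵢ₊₁⇒orbitᵢ : orbit next a (suc (toℕ i)) ⇒ orbit next a (toℕ i)
      orbitᵢ₊₁⇒orbitᵢ =
        subst (_ ⇒_) (sym orbitᵢ≡orbitⱼ) (orbit-ascending next inflationary a (≤⇒≤′ i<j))

    -- The arc relation is not decidable, so a maximal element is only available up to
    -- double negation; this suffices because it is used to derive ⊥.
    ¬¬-maximal : V G → ¬ ¬ ∃ Maximal
    ¬¬-maximal a ¬maximal =
      ¬¬-∀-Fin (n G) ¬¬strict-successor λ succ →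
        no-strict-successor-function a (λ x → proj₁ (succ x))
          (λ x → proj₁ (proj₂ (succ x))) (λ x → proj₂ (proj₂ (succ x)))
      where
      ¬¬strict-successor : ∀ x → ¬ ¬ (Σ (V G) λ y → x ⇒ y × y ≢ x)
      ¬¬strict-successor x ¬succ = ¬maximal (x , maximal)
        where
        maximal : Maximal x
        maximal z x⇒z with z ≟ x
        ... | yes z≡x = z≡x
        ... | no  z≢x = ⊥-elim (¬succ (z , x⇒z , z≢x))

  module _ (reflexive : Reflexive G) (trivial : IdempotentTrivial G)
           (f : V G → V G) (f-endo : IsEndo G f) (id⇒f : ∀ x y → x ⇒ y → x ⇒ f y)
           (a : V G) (fa≢a : f a ≢ a) where

    inflationary : ∀ x → x ⇒ f x
    inflationary x = id⇒f x x (reflexive x)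

    redirect : V G → V G → V G
    redirect x y with y ≟ a | x ≟ a
    ... | yes _ | no _ = f a
    ... | _     | _    = y

    redirect-idem : ∀ x → redirect x x ≡ x
    redirect-idem x with x ≟ a
    ... | yes _ = refl
    ... | no  _ = refl

    -- The two hypotheses cover the only arcs whose image starts at f a and ends elsewhere;
    -- they are where the symmetric and the intransitive cases differ.
    redirect-poly : (∀ y → a ⇒ y → y ≢ a → f a ⇒ y) →
                    (∀ x → x ⇒ a → x ≢ a → f a ⇒ a) →
                    redirect Preserves₂ _⇒_ ⟶ _⇒_ ⟶ _⇒_
    redirect-poly out-neighbour in-neighbour {x} {x'} {y} {y'} x⇒x' y⇒y'
      with y ≟ a | x ≟ a | y' ≟ a | x' ≟ a
    ... | yes _    | no _   | yes _    | no _     = reflexive (f a)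
    ... | yes refl | no x≢a | yes refl | yes refl = in-neighbour x x⇒x' x≢a
    ... | yes refl | no _   | no y'≢a  | _        = out-neighbour y' y⇒y' y'≢a
    ... | yes _    | yes _  | yes refl | no _     = id⇒f y a y⇒y'
    ... | no _     | _      | yes refl | no _     = id⇒f y a y⇒y'
    ... | yes _    | yes _  | yes _    | yes _    = y⇒y'
    ... | yes _    | yes _  | no _     | _        = y⇒y'
    ... | no _     | _      | yes _    | yes _    = y⇒y'
    ... | no _     | _      | no _     | _        = y⇒y'

    redirect-a-fa : redirect a (f a) ≡ f a
    redirect-a-fa with f a ≟ a | a ≟ a
    ... | yes fa≡a | _      = ⊥-elim (fa≢a fa≡a)
    ... | no _     | yes _  = refl
    ... | no _     | no a≢a = ⊥-elim (a≢a refl)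

    redirect-fa-a : redirect (f a) a ≡ f a
    redirect-fa-a with a ≟ a | f a ≟ a
    ... | yes _  | no _     = refl
    ... | yes _  | yes fa≡a = ⊥-elim (fa≢a fa≡a)
    ... | no a≢a | _        = ⊥-elim (a≢a refl)

    redirect-not-projection : ¬ ((∀ x y → redirect x y ≡ x) ⊎ (∀ x y → redirect x y ≡ y))
    redirect-not-projection (inj₁ π₁) = fa≢a (trans (sym redirect-a-fa) (π₁ a (f a)))
    redirect-not-projection (inj₂ π₂) = fa≢a (trans (sym redirect-fa-a) (π₂ (f a) a))

    symmetric-case : IsSymmetric G → ⊥
    symmetric-case symmetric = redirect-not-projection
      (binary-polymorphism-is-projection trivial redirect
        (redirect-poly out-neighbour in-neighbour) redirect-idem)
      where
      out-neighbour : ∀ y → a ⇒ y → y ≢ a → f a ⇒ y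
      out-neighbour y a⇒y _ = symmetric y (f a) (id⇒f y a (symmetric a y a⇒y))
      in-neighbour : ∀ x → x ⇒ a → x ≢ a → f a ⇒ a
      in-neighbour _ _ _ = symmetric a (f a) (inflationary a)

    intransitive-case : IsIntransitive G → ⊥
    intransitive-case intransitive = redirect-not-projection
      (binary-polymorphism-is-projection trivial redirect
        (redirect-poly out-neighbour in-neighbour) redirect-idem)
      where
      in-neighbour≡fa : ∀ x → x ⇒ a → x ≢ a → x ≡ f a
      in-neighbour≡fa x x⇒a x≢a with x ≟ f a
      ... | yes x≡fa = x≡fa
      ... | no x≢fa  = ⊥-elim (intransitive x a (f a) x≢a (fa≢a ∘ sym) x≢fa
                                (x⇒a , inflationary a , id⇒f x a x⇒a))
      in-neighbour : ∀ x → x ⇒ a → x ≢ a → f a ⇒ a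
      in-neighbour x x⇒a x≢a = subst (_⇒ a) (in-neighbour≡fa x x⇒a x≢a) x⇒a
      out-neighbour : ∀ y → a ⇒ y → y ≢ a → f a ⇒ y
      out-neighbour y a⇒y y≢a with y ≟ f a | f y ≟ y | f y ≟ a
      ... | yes refl | _        | _ = reflexive (f a)
      ... | no _     | yes fy≡y | _ = subst (f a ⇒_) fy≡y (f-endo a y a⇒y)
      ... | no y≢fa  | no _     | yes fy≡a =
        ⊥-elim (y≢fa (in-neighbour≡fa y (subst (y ⇒_) fy≡a (inflationary y)) y≢a))
      ... | no _     | no fy≢y  | no fy≢a =
        ⊥-elim (intransitive a y (f y) (y≢a ∘ sym) (fy≢y ∘ sym) (fy≢a ∘ sym)
                 (a⇒y , inflationary y , id⇒f a y a⇒y))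

    module _ (poset : IsPoset G) (c : V G) (c-maximal : Maximal c) where
      apply-f-at-c : V G → V G → V G
      apply-f-at-c x y with y ≟ c
      ... | yes _ = f x
      ... | no  _ = x

      apply-f-at-c-idem : ∀ x → apply-f-at-c x x ≡ x
      apply-f-at-c-idem x with x ≟ c
      ... | yes refl = c-maximal (f x) (inflationary x)
      ... | no  _    = refl

      apply-f-at-c-poly : apply-f-at-c Preserves₂ _⇒_ ⟶ _⇒_ ⟶ _⇒_
      apply-f-at-c-poly {x} {x'} {y} {y'} x⇒x' y⇒y' with y ≟ c | y' ≟ c
      ... | yes _    | yes _   = f-endo x x' x⇒x'
      ... | yes refl | no y'≢c = ⊥-elim (y'≢c (c-maximal y' y⇒y'))
      ... | no _     | yes _   = proj₂ (proj₂ poset) x x' (f x') x⇒x' (inflationary x')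
      ... | no _     | no _    = x⇒x'

      apply-f-at-c-a-c : apply-f-at-c a c ≡ f a
      apply-f-at-c-a-c with c ≟ c
      ... | yes _  = refl
      ... | no c≢c = ⊥-elim (c≢c refl)

      apply-f-at-c-fa-a : apply-f-at-c (f a) a ≡ f a
      apply-f-at-c-fa-a with a ≟ c
      ... | yes refl = ⊥-elim (fa≢a (c-maximal (f a) (inflationary a)))
      ... | no _     = refl

      maximal-case : ⊥
      maximal-case with binary-polymorphism-is-projection trivial apply-f-at-c
                          apply-f-at-c-poly apply-f-at-c-idem
      ... | inj₁ π₁ = fa≢a (trans (sym apply-f-at-c-a-c) (π₁ a c))
      ... | inj₂ π₂ = fa≢a (trans (sym apply-f-at-c-fa-a) (π₂ (f a) a))

    poset-case : IsPoset G → ⊥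
    poset-case poset = ¬¬-maximal poset a λ (c , c-maximal) → maximal-case poset c c-maximal

  arc-from-id-is-id : Reflexive G → IsPoset G ⊎ IsSymmetric G ⊎ IsIntransitive G →
                      IdempotentTrivial G → (f : Endo G) → HomArc G (idEndo G) f →
                      proj₁ f ≗ id
  arc-from-id-is-id reflexive class trivial (f , f-endo) id⇒f a with f a ≟ a | class
  ... | yes fa≡a | _ = fa≡a
  ... | no fa≢a  | inj₁ poset =
    ⊥-elim (poset-case reflexive trivial f f-endo id⇒f a fa≢a poset)
  ... | no fa≢a  | inj₂ (inj₁ symmetric) =
    ⊥-elim (symmetric-case reflexive trivial f f-endo id⇒f a fa≢a symmetric)
  ... | no fa≢a  | inj₂ (inj₂ intransitive) =
    ⊥-elim (intransitive-case reflexive trivial f f-endo id⇒f a fa≢a intransitive)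

opposite : Digraph → Digraph
opposite G = record { n = n G ; E = λ x y → E G y x }

opposite-class : ∀ {G} → IsPoset G ⊎ IsSymmetric G ⊎ IsIntransitive G →
                 IsPoset (opposite G) ⊎ IsSymmetric (opposite G) ⊎ IsIntransitive (opposite G)
opposite-class (inj₁ (reflexive , antisym , trans⇒)) =
  inj₁ (reflexive , (λ x y yx xy → antisym x y xy yx) , λ x y z yx zy → trans⇒ z y x zy yx)
opposite-class (inj₂ (inj₁ symmetric)) = inj₂ (inj₁ λ x y yx → symmetric y x yx)
opposite-class (inj₂ (inj₂ intransitive)) = inj₂ (inj₂ λ x y z x≢y y≢z x≢z (yx , zy , zx) →
  intransitive z y x (y≢z ∘ sym) (x≢y ∘ sym) (x≢z ∘ sym) (zy , yx , zx))

opposite-trivial : ∀ G → IdempotentTrivial G → IdempotentTrivial (opposite G)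
opposite-trivial G trivial k k≥2 f f-poly = trivial k k≥2 f (λ x y yx → f-poly y x yx)

-- An arc f → id of Hom(G,G) is an arc id → f of Hom(Gᵒᵖ,Gᵒᵖ).
arc-to-id-is-id : (G : Digraph) → Reflexive G → IsPoset G ⊎ IsSymmetric G ⊎ IsIntransitive G →
                  IdempotentTrivial G → (f : Endo G) → HomArc G f (idEndo G) →
                  proj₁ f ≗ id
arc-to-id-is-id G reflexive class trivial (f , f-endo) f⇒id =
  arc-from-id-is-id (opposite G) reflexive (opposite-class class) (opposite-trivial G trivial)
    (f , λ x y yx → f-endo y x yx) (λ x y yx → f⇒id y x yx)

HomArc-respˡ-≗ : ∀ G {f g h : Endo G} → proj₁ f ≗ proj₁ g → HomArc G f h → HomArc G g h
HomArc-respˡ-≗ G {h = h} f≗g f⇒h x y xy = subst (λ z → E G z (proj₁ h y)) (f≗g x) (f⇒h x y xy)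

HomArc-respʳ-≗ : ∀ G {f g h : Endo G} → proj₁ f ≗ proj₁ g → HomArc G h f → HomArc G h g
HomArc-respʳ-≗ G {h = h} f≗g h⇒f x y xy = subst (E G (proj₁ h x)) (f≗g y) (h⇒f x y xy)

lemma3p6 : (G : Digraph) → Reflexive G →
           (IsPoset G ⊎ IsSymmetric G ⊎ IsIntransitive G) →
           IdempotentTrivial G → IdIsolated G
lemma3p6 G reflexive class trivial f id~f = along id~f (λ _ → refl)
  where
  step : ∀ {g h : Endo G} → SymClosure (HomArc G) g h → proj₁ g ≗ id → proj₁ h ≗ id
  step {g} {h} (fwd g⇒h) g≗id = arc-from-id-is-id G reflexive class trivial h
    (HomArc-respˡ-≗ G {g} {idEndo G} {h} g≗id g⇒h)
  step {g} {h} (bwd h⇒g) g≗id = arc-to-id-is-id G reflexive class trivial h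
    (HomArc-respʳ-≗ G {g} {idEndo G} {h} g≗id h⇒g)

  along : ∀ {g h : Endo G} → Star (SymClosure (HomArc G)) g h → proj₁ g ≗ id → proj₁ h ≗ id
  along ε          = id
  along (s ◅ path) = along path ∘ step s
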